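{- Let $n\geq 1$ be an integer and $a$ an integer with $2^{n-1}\leq a<2^n$; let $I=[-a,a]\cap{\mathbb Z}$. (i) If $n>4$, there exist $n$ distinct integers $\alpha_1,\dots,\alpha_n$ with $0<\alpha_j<a$ such that $\sum_j\alpha_j=a$ and every integer $z\in[0,a]$ can be written as $z=\sum_{j\in Z}\alpha_j$ for some subset $Z\subset\{1,\dots,n\}$. (ii) The minimal number of ${\mathbb S}$-generators of $(H{\mathbb Z})_I$ is $n+1$; that is, the smallest cardinality of a subset $G\subset I$ such that for every $x\in I$ there is a subset $Z\subset G$ with $\sum_{g\in Z} g=x$ and $\sum_{g\in Z'} g\in I$ for every $Z'\subset Z$, equals $n+1$.
   Context: For a subset $X\subset{\mathbb Z}$ containing $0$, $(H{\mathbb Z})_X$ is the ${\mathbb S}$-module with $(H{\mathbb Z})_X(k_+)=\{a\in{\mathbb Z}^k\mid \sum_{j\in Z}a_j\in X\ \forall Z\subset\{1,\dots,k\}\}$. The minimal number of ${\mathbb S}$-generators (the dimension $\dim_{\mathbb S}$) of $(H{\mathbb Z})_I$ is the smallest cardinality of a subset $G\subset I$ with the property stated in (ii). -}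

module Defs where

open import Data.Bool using (Bool; true; false)
open import Data.Nat as ℕ using (ℕ; _+_; _≤_; _<_; _^_; _∸_)
open import Data.Fin using (Fin; zero; suc)
open import Data.Fin.Subset using (Subset; ⊤)
open import Data.Vec using ([]; _∷_)
open import Data.Integer as ℤ using (ℤ; +_; -_)
open import Data.List using (List; length; foldr)
open import Data.List.Relation.Unary.All using (All)
open import Data.List.Relation.Unary.Unique.Propositional using (Unique)
open import Data.List.Relation.Binary.Sublist.Propositional using (_⊆_)
open import Data.Product using (Σ; ∃; _×_)
open import Function using (_∘_)
open import Function.Definitions using (Injective)
open import Relation.Binary.PropositionalEquality using (_≡_)

subsetSum : ∀ {n} → Subset n → (Fin n → ℕ) → ℕ
subsetSum [] f = 0
subsetSum (true ∷ p) f = f zero + subsetSum p (f ∘ suc)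
subsetSum (false ∷ p) f = subsetSum p (f ∘ suc)

totalSum : ∀ {n} → (Fin n → ℕ) → ℕ
totalSum = subsetSum ⊤

InI : ℕ → ℤ → Set
InI a x = (- (+ a)) ℤ.≤ x × x ℤ.≤ (+ a)

sumℤ : List ℤ → ℤ
sumℤ = foldr ℤ._+_ (+ 0)

-- A finite subset G ⊂ I, represented as a duplicate-free list of elements of I.
-- Subsets Z ⊂ G correspond to sublists of G.
IsSubsetOfI : ℕ → List ℤ → Set
IsSubsetOfI a G = Unique G × All (InI a) G

Generates : ℕ → List ℤ → Set
Generates a G =
  ∀ x → InI a x →
    Σ (List ℤ) λ Z → Z ⊆ G × sumℤ Z ≡ x × (∀ Z' → Z' ⊆ Z → InI a (sumℤ Z'))

MinGenCard : ℕ → ℕ → Set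
MinGenCard a d =
  (Σ (List ℤ) λ G → IsSubsetOfI a G × Generates a G × length G ≡ d)
  × (∀ G → IsSubsetOfI a G → Generates a G → d ≤ length G)

PartI : ℕ → ℕ → Set
PartI n a =
  Σ (Fin n → ℕ) λ α →
    Injective _≡_ _≡_ α
    × (∀ j → 0 < α j × α j < a)
    × totalSum α ≡ a
    × (∀ z → z ≤ a → Σ (Subset n) λ Z → subsetSum Z α ≡ z)

-- (i) Halving: a = (⌊a/2⌋ + a mod 2) + ⌊a/2⌋, where ⌊a/2⌋ is split recursively into n − 1 parts.
-- Keeping every part at most ⌈a/2⌉ makes the new part larger than all old ones, and at most
-- one more than their sum; parts with these two properties are distinct and every z ≤ a is
-- a subset sum of them (greedily).
-- (ii) G = {−a, 2⁰, …, 2ⁿ⁻¹} generates: x ≥ 0 is a binary expansion, and x < 0 is −a plus the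
-- binary expansion of a + x; the partial sums of such a sum lie in [−a, 0] or [0, a]. Conversely
-- every element of I is a subset sum of G, so 2a + 1 ≤ 2^|G|, which together with 2ⁿ ≤ 2a forces |G| > n.
module Submission where

open import Defs

module Splittings where

  open import Data.Bool using (true; false)
  open import Data.Nat
  open import Data.Nat.Properties
  open import Data.Nat.DivMod using (_/_; _%_; m≡m%n+[m/n]*n; m%n<n; m*n/n≡m; /-monoˡ-≤; m<n*o⇒m/o<n)
  open import Data.Nat.Tactic.RingSolver using (solve-∀)
  open import Data.Fin using (Fin; zero; suc; toℕ; fromℕ<)
  import Data.Fin.Properties as Fin
  open import Data.Fin.Subset using (Subset)
  open import Data.Vec using (Vec; []; _∷_; lookup; sum)
  open import Data.Vec.Relation.Unary.All as All using (All; []; _∷_; all?)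
  open import Data.Vec.Relation.Unary.All.Properties using (lookup⁺)
  open import Data.Product using (Σ; _×_; _,_; proj₂)
  open import Data.Empty using (⊥-elim)
  open import Function.Definitions using (Injective)
  open import Relation.Nullary using (Dec; yes; no)
  open import Relation.Nullary.Decidable using (toWitness; map′; _×-dec_)
  open import Relation.Binary.PropositionalEquality

  data CompleteDesc : ∀ {n} → Vec ℕ n → Set where
    [] : CompleteDesc []
    cons : ∀ {n m} {v : Vec ℕ n} →
      All (_< m) v → m ≤ suc (sum v) → CompleteDesc v → CompleteDesc (m ∷ v)

  completeDesc? : ∀ {n} (v : Vec ℕ n) → Dec (CompleteDesc v)
  completeDesc? [] = yes []
  completeDesc? (m ∷ v) =
    map′ (λ ((below , bound) , rest) → cons below bound rest)
         (λ { (cons below bound rest) → (below , bound) , rest })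
         ((all? (_<? m) v ×-dec m ≤? suc (sum v)) ×-dec completeDesc? v)

  lookup-injective : ∀ {n} {v : Vec ℕ n} → CompleteDesc v → Injective _≡_ _≡_ (lookup v)
  lookup-injective (cons _ _ _) {zero} {zero} _ = refl
  lookup-injective (cons below _ _) {zero} {suc j} eq = ⊥-elim (<-irrefl (sym eq) (lookup⁺ below j))
  lookup-injective (cons below _ _) {suc i} {zero} eq = ⊥-elim (<-irrefl eq (lookup⁺ below i))
  lookup-injective (cons _ _ rest) {suc i} {suc j} eq = cong suc (lookup-injective rest eq)

  -- Greedy: take the largest part exactly when the remaining parts cannot reach z.
  subsetSum-surjective : ∀ {n} {v : Vec ℕ n} → CompleteDesc v →
    ∀ z → z ≤ sum v → Σ (Subset n) λ Z → subsetSum Z (lookup v) ≡ z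
  subsetSum-surjective [] z z≤0 = [] , sym (n≤0⇒n≡0 z≤0)
  subsetSum-surjective {v = m ∷ v} (cons _ m≤ rest) z z≤ with z ≤? sum v
  ... | yes z≤rest =
    let Z , eq = subsetSum-surjective rest z z≤rest in false ∷ Z , eq
  ... | no z≰rest =
    let m≤z = ≤-trans m≤ (≰⇒> z≰rest)
        Z , eq = subsetSum-surjective rest (z ∸ m) (m≤n+o⇒m∸n≤o z m z≤)
    in true ∷ Z , trans (cong (m +_) eq) (m+[n∸m]≡n m≤z)

  totalSum-lookup : ∀ {n} (v : Vec ℕ n) → totalSum (lookup v) ≡ sum v
  totalSum-lookup [] = refl
  totalSum-lookup (x ∷ v) = cong (x +_) (totalSum-lookup v)

  record Splitting (s : ℕ) {n : ℕ} (v : Vec ℕ n) : Set where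
    field
      completeDesc : CompleteDesc v
      positive     : All (0 <_) v
      atMostHalf   : All (λ x → 2 * x ≤ suc s) v
      sum≡         : sum v ≡ s

  splitting? : ∀ s {n} (v : Vec ℕ n) → Dec (Splitting s v)
  splitting? s v =
    map′ (λ (c , p , h , e) → record { completeDesc = c ; positive = p ; atMostHalf = h ; sum≡ = e })
         (λ σ → let open Splitting σ in completeDesc , positive , atMostHalf , sum≡)
         (completeDesc? v ×-dec all? (0 <?_) v ×-dec all? (λ x → 2 * x ≤? suc s) v ×-dec sum v ≟ s)

  2*x≤1+r⇒x<r : ∀ {r x} → 2 ≤ r → 2 * x ≤ suc r → x < r
  2*x≤1+r⇒x<r {r} {x} 2≤r 2x≤ = *-cancelˡ-< 2 x r (begin-strict
    2 * x   ≤⟨ 2x≤ ⟩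
    1 + r   <⟨ +-monoˡ-< r 2≤r ⟩
    r + r   ≡⟨ cong (r +_) (sym (+-identityʳ r)) ⟩
    2 * r   ∎)
    where open ≤-Reasoning

  cons-splitting : ∀ {r h n} {v : Vec ℕ n} → 2 ≤ r → r ≤ h → h ≤ suc r →
    Splitting r v → Splitting (h + r) (h ∷ v)
  cons-splitting {r} {h} {v = v} 2≤r r≤h h≤1+r σ = record
    { completeDesc = cons (All.map (λ 2x≤ → <-≤-trans (2*x≤1+r⇒x<r 2≤r 2x≤) r≤h) atMostHalf)
                          (subst (λ t → h ≤ suc t) (sym sum≡) h≤1+r) completeDesc
    ; positive     = ≤-trans (≤-trans (s≤s z≤n) 2≤r) r≤h ∷ positive
    ; atMostHalf   = head-bound ∷ All.map (λ 2x≤ → ≤-trans 2x≤ (s≤s (m≤n+m r h))) atMostHalf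
    ; sum≡         = cong (h +_) sum≡
    }
    where
    open Splitting σ
    head-bound : 2 * h ≤ suc (h + r)
    head-bound = begin
      2 * h         ≡⟨ cong (h +_) (+-identityʳ h) ⟩
      h + h         ≤⟨ +-monoʳ-≤ h h≤1+r ⟩
      h + suc r     ≡⟨ +-suc h r ⟩
      suc (h + r)   ∎
      where open ≤-Reasoning

  Splitting⇒PartI : ∀ {n a} {v : Vec ℕ n} → 2 ≤ a → Splitting a v → PartI n a
  Splitting⇒PartI {a = a} {v} 2≤a σ =
    lookup v ,
    lookup-injective completeDesc ,
    (λ j → lookup⁺ positive j , 2*x≤1+r⇒x<r 2≤a (lookup⁺ atMostHalf j)) ,
    trans (totalSum-lookup v) sum≡ ,
    λ z z≤a → subsetSum-surjective completeDesc z (subst (z ≤_) (sym sum≡) z≤a)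
    where open Splitting σ

  -- Four parts do not suffice for s = 8 (four distinct positive parts sum to at least 10),
  -- so the recursion bottoms out at five parts, tabulated for 16 ≤ s < 32.
  splittings₅ : Vec (Vec ℕ 5) 16
  splittings₅ =
      (6 ∷ 4 ∷ 3 ∷ 2 ∷ 1 ∷ [])
    ∷ (7 ∷ 4 ∷ 3 ∷ 2 ∷ 1 ∷ [])
    ∷ (8 ∷ 4 ∷ 3 ∷ 2 ∷ 1 ∷ [])
    ∷ (9 ∷ 4 ∷ 3 ∷ 2 ∷ 1 ∷ [])
    ∷ (10 ∷ 4 ∷ 3 ∷ 2 ∷ 1 ∷ [])
    ∷ (11 ∷ 4 ∷ 3 ∷ 2 ∷ 1 ∷ [])
    ∷ (11 ∷ 5 ∷ 3 ∷ 2 ∷ 1 ∷ [])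
    ∷ (12 ∷ 5 ∷ 3 ∷ 2 ∷ 1 ∷ [])
    ∷ (12 ∷ 6 ∷ 3 ∷ 2 ∷ 1 ∷ [])
    ∷ (13 ∷ 6 ∷ 3 ∷ 2 ∷ 1 ∷ [])
    ∷ (13 ∷ 7 ∷ 3 ∷ 2 ∷ 1 ∷ [])
    ∷ (14 ∷ 7 ∷ 3 ∷ 2 ∷ 1 ∷ [])
    ∷ (14 ∷ 7 ∷ 4 ∷ 2 ∷ 1 ∷ [])
    ∷ (15 ∷ 7 ∷ 4 ∷ 2 ∷ 1 ∷ [])
    ∷ (15 ∷ 8 ∷ 4 ∷ 2 ∷ 1 ∷ [])
    ∷ (16 ∷ 8 ∷ 4 ∷ 2 ∷ 1 ∷ [])
    ∷ []

  splittings₅-valid : ∀ i → Splitting (16 + toℕ i) (lookup splittings₅ i)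
  splittings₅-valid = toWitness {a? = Fin.all? λ i → splitting? (16 + toℕ i) (lookup splittings₅ i)} _

  splitting₅ : ∀ s → 16 ≤ s → s < 32 → Σ (Vec ℕ 5) (Splitting s)
  splitting₅ s 16≤s s<32 =
    lookup splittings₅ i ,
    subst (λ t → Splitting t (lookup splittings₅ i))
          (trans (cong (16 +_) (Fin.toℕ-fromℕ< s∸16<16)) (m+[n∸m]≡n 16≤s))
          (splittings₅-valid i)
    where
    s∸16<16 : s ∸ 16 < 16
    s∸16<16 = ∸-monoˡ-< s<32 16≤s
    i : Fin 16
    i = fromℕ< s∸16<16

  2≤2^[1+k] : ∀ k → 2 ≤ 2 ^ suc k
  2≤2^[1+k] k = *-monoʳ-≤ 2 (m^n>0 2 k)

  half-bounds : ∀ k s → 2 ^ suc k ≤ s → s < 2 ^ suc (suc k) → 2 ^ k ≤ s / 2 × s / 2 < 2 ^ suc k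
  half-bounds k s lo hi =
    subst (_≤ s / 2) (trans (cong (_/ 2) (*-comm 2 (2 ^ k))) (m*n/n≡m (2 ^ k) 2)) (/-monoˡ-≤ 2 lo) ,
    m<n*o⇒m/o<n (subst (s <_) (*-comm 2 (2 ^ suc k)) hi)

  m/2+m%2≤1+m/2 : ∀ m → m / 2 + m % 2 ≤ suc (m / 2)
  m/2+m%2≤1+m/2 m = subst (m / 2 + m % 2 ≤_) (+-comm (m / 2) 1) (+-monoʳ-≤ (m / 2) (s≤s⁻¹ (m%n<n m 2)))

  m/2+m%2+m/2≡m : ∀ m → m / 2 + m % 2 + m / 2 ≡ m
  m/2+m%2+m/2≡m m = begin
    m / 2 + m % 2 + m / 2   ≡⟨ rearrange (m / 2) (m % 2) ⟩
    m % 2 + m / 2 * 2       ≡⟨ sym (m≡m%n+[m/n]*n m 2) ⟩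
    m                       ∎
    where
    open ≡-Reasoning
    rearrange : ∀ x y → x + y + x ≡ y + x * 2
    rearrange = solve-∀

  splitting : ∀ k s → 2 ^ (4 + k) ≤ s → s < 2 ^ (5 + k) → Σ (Vec ℕ (5 + k)) (Splitting s)
  splitting zero s lo hi = splitting₅ s lo hi
  splitting (suc k) s lo hi with half-bounds (4 + k) s lo hi
  ... | r-lo , r-hi with splitting k (s / 2) r-lo r-hi
  ...   | v , σ =
    s / 2 + s % 2 ∷ v ,
    subst (λ t → Splitting t (s / 2 + s % 2 ∷ v)) (m/2+m%2+m/2≡m s)
      (cons-splitting (≤-trans (2≤2^[1+k] (3 + k)) r-lo) (m≤m+n (s / 2) (s % 2)) (m/2+m%2≤1+m/2 s) σ)

  partI : ∀ {n} a → 4 < n → 2 ^ (n ∸ 1) ≤ a → a < 2 ^ n → PartI n a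
  partI {suc (suc (suc (suc (suc k))))} a (s≤s (s≤s (s≤s (s≤s (s≤s _))))) lo hi =
    Splitting⇒PartI (≤-trans (2≤2^[1+k] (3 + k)) lo) (proj₂ (splitting k a lo hi))

module GeneratingSets where

  open import Data.Nat as ℕ using (ℕ; zero; suc; _^_; z≤n; s≤s)
  import Data.Nat.Properties as ℕ
  open import Data.Integer using (ℤ; +_; -[1+_]; -_; _+_; _⊖_; _≤_; 0ℤ; +≤+; nonNegative)
  open import Data.Integer.Properties
  open import Data.Integer.Tactic.RingSolver using (solve-∀)
  open import Data.Fin using (Fin; toℕ)
  import Data.Fin.Properties as Fin
  open import Data.List using (List; []; _∷_; length; map; _++_; applyDownFrom; lookup)
  open import Data.List.Properties using (length-++; length-map; length-applyDownFrom)
  open import Data.List.Relation.Unary.All using (All; []; _∷_)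
  import Data.List.Relation.Unary.All.Properties as All
  open import Data.List.Relation.Unary.Any using (here; index)
  open import Data.List.Relation.Unary.Any.Properties using (lookup-index)
  open import Data.List.Relation.Unary.Unique.Propositional using (Unique; _∷_)
  import Data.List.Relation.Unary.Unique.Propositional.Properties as Unique
  open import Data.List.Relation.Binary.Sublist.Propositional using (_⊆_; []; _∷_; _∷ʳ_)
  open import Data.List.Relation.Binary.Sublist.Propositional.Properties using (All-resp-⊆)
  open import Data.List.Membership.Propositional using (_∈_)
  open import Data.List.Membership.Propositional.Properties using (∈-map⁺; ∈-++⁺ˡ; ∈-++⁺ʳ)
  open import Data.Product using (Σ; _×_; _,_)
  open import Data.Empty using (⊥-elim)
  open import Function.Definitions using (Injective)
  open import Relation.Binary.PropositionalEquality
  open import Relation.Nullary using (yes; no)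

  powersOfTwo : ℕ → List ℤ
  powersOfTwo = applyDownFrom λ k → + (2 ^ k)

  m<2^[1+n]⇒m∸2^n<2^n : ∀ {m} n → m ℕ.< 2 ^ suc n → 2 ^ n ℕ.≤ m → m ℕ.∸ 2 ^ n ℕ.< 2 ^ n
  m<2^[1+n]⇒m∸2^n<2^n {m} n m<2^[1+n] 2^n≤m =
    subst (m ℕ.∸ 2 ^ n ℕ.<_) (trans (ℕ.m+n∸m≡n (2 ^ n) _) (ℕ.+-identityʳ (2 ^ n))) (ℕ.∸-monoˡ-< m<2^[1+n] 2^n≤m)

  binary-expansion : ∀ n {x} → x ℕ.< 2 ^ n → Σ (List ℤ) λ Z → Z ⊆ powersOfTwo n × sumℤ Z ≡ + x
  binary-expansion zero {zero} _ = [] , [] , refl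
  binary-expansion zero {suc _} (s≤s ())
  binary-expansion (suc n) {x} x<2^[1+n] with x ℕ.<? 2 ^ n
  ... | yes x<2^n =
    let Z , Z⊆ , ΣZ≡x = binary-expansion n x<2^n in Z , _ ∷ʳ Z⊆ , ΣZ≡x
  ... | no x≮2^n =
    let 2^n≤x = ℕ.≮⇒≥ x≮2^n
        Z , Z⊆ , ΣZ≡ = binary-expansion n (m<2^[1+n]⇒m∸2^n<2^n n x<2^[1+n] 2^n≤x)
    in + 2 ^ n ∷ Z , refl ∷ Z⊆ , trans (cong (_+_ (+ 2 ^ n)) ΣZ≡) (cong +_ (ℕ.m+[n∸m]≡n 2^n≤x))

  powersOfTwo-nonNegative : ∀ n → All (0ℤ ≤_) (powersOfTwo n)
  powersOfTwo-nonNegative n = All.applyDownFrom⁺₂ _ n (λ _ → +≤+ z≤n)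

  sublist-sum-bounds : ∀ {Z Z'} → All (0ℤ ≤_) Z → Z' ⊆ Z → 0ℤ ≤ sumℤ Z' × sumℤ Z' ≤ sumℤ Z
  sublist-sum-bounds [] [] = ≤-refl , ≤-refl
  sublist-sum-bounds {y ∷ _} (0≤y ∷ nonNeg) (_ ∷ʳ Z'⊆Z) =
    let lo , hi = sublist-sum-bounds nonNeg Z'⊆Z in lo , i≤j⇒i≤k+j y {{nonNegative 0≤y}} hi
  sublist-sum-bounds {y ∷ _} (0≤y ∷ nonNeg) (refl ∷ Z'⊆Z) =
    let lo , hi = sublist-sum-bounds nonNeg Z'⊆Z in +-mono-≤ 0≤y lo , +-monoʳ-≤ y hi

  sublist-sums-∈I : ∀ {a Z} → All (0ℤ ≤_) Z → sumℤ Z ≤ + a →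
    ∀ Z' → Z' ⊆ - (+ a) ∷ Z → InI a (sumℤ Z')
  sublist-sums-∈I {a} nonNeg ΣZ≤a Z' (_ ∷ʳ Z'⊆Z) =
    let lo , hi = sublist-sum-bounds nonNeg Z'⊆Z in ≤-trans neg-≤-pos lo , ≤-trans hi ΣZ≤a
  sublist-sums-∈I {a} nonNeg ΣZ≤a (_ ∷ Z') (refl ∷ Z'⊆Z) =
    let lo , hi = sublist-sum-bounds nonNeg Z'⊆Z in
    i≤i+j (- (+ a)) (sumℤ Z') {{nonNegative lo}} ,
    ≤-trans (≤-reflexive (+-comm (- (+ a)) (sumℤ Z'))) (i≤j⇒i-k≤j (+ a) (≤-trans hi ΣZ≤a))

  binary-expansion-≤ : ∀ {n a y} → a ℕ.< 2 ^ n → 0ℤ ≤ y → y ≤ + a →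
    Σ (List ℤ) λ Z → Z ⊆ powersOfTwo n × sumℤ Z ≡ y × All (0ℤ ≤_) Z
  binary-expansion-≤ {n} a<2^n (+≤+ _) (+≤+ y≤a) =
    let Z , Z⊆ , ΣZ≡y = binary-expansion n (ℕ.≤-<-trans y≤a a<2^n) in
    Z , Z⊆ , ΣZ≡y , All-resp-⊆ Z⊆ (powersOfTwo-nonNegative n)

  powersOfTwo-generates : ∀ {n a} → a ℕ.< 2 ^ n → Generates a (- (+ a) ∷ powersOfTwo n)
  powersOfTwo-generates {n} {a} a<2^n (+ k) (_ , k≤a) =
    let Z , Z⊆ , ΣZ≡x , nonNeg = binary-expansion-≤ {n} a<2^n (+≤+ z≤n) k≤a in
    Z , _ ∷ʳ Z⊆ , ΣZ≡x ,
    λ Z' Z'⊆Z → sublist-sums-∈I nonNeg (≤-trans (≤-reflexive ΣZ≡x) k≤a) Z' (_ ∷ʳ Z'⊆Z)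
  powersOfTwo-generates {n} {a} a<2^n x@(-[1+ k ]) (-a≤x , _) =
    let Z , Z⊆ , ΣZ≡a+x , nonNeg = binary-expansion-≤ {n} a<2^n 0≤a+x a+x≤a in
    - (+ a) ∷ Z , refl ∷ Z⊆ ,
    trans (cong (_+_ (- (+ a))) ΣZ≡a+x) (cancel (+ a) x) ,
    sublist-sums-∈I nonNeg (≤-trans (≤-reflexive ΣZ≡a+x) a+x≤a)
    where
    0≤a+x : 0ℤ ≤ + a + x
    0≤a+x = subst (_≤ + a + x) (+-inverseʳ (+ a)) (+-monoʳ-≤ (+ a) -a≤x)
    a+x≤a : + a + x ≤ + a
    a+x≤a = i≤j⇒i-k≤j (+ suc k) ≤-refl
    cancel : ∀ i j → - i + (i + j) ≡ j
    cancel = solve-∀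

  powersOfTwo-unique : ∀ n → Unique (powersOfTwo n)
  powersOfTwo-unique n = Unique.applyDownFrom⁺₁ _ n λ j<i _ eq →
    ℕ.<⇒≢ (ℕ.^-monoʳ-< 2 (s≤s (s≤s z≤n)) j<i) (sym (+-injective eq))

  powersOfTwo-∈I : ∀ {m a} → 2 ^ m ℕ.≤ a → All (InI a) (powersOfTwo (suc m))
  powersOfTwo-∈I {m} 2^m≤a = All.applyDownFrom⁺₁ _ (suc m) λ i≤m →
    neg-≤-pos , +≤+ (ℕ.≤-trans (ℕ.^-monoʳ-≤ 2 (ℕ.s≤s⁻¹ i≤m)) 2^m≤a)

  powersOfTwo-isSubsetOfI : ∀ {m a} → 2 ^ m ℕ.≤ a → IsSubsetOfI a (- (+ a) ∷ powersOfTwo (suc m))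
  powersOfTwo-isSubsetOfI {m} {suc a} 2^m≤a =
    All.applyDownFrom⁺₂ _ (suc m) (λ _ ()) ∷ powersOfTwo-unique (suc m) ,
    (≤-refl , neg-≤-pos) ∷ powersOfTwo-∈I 2^m≤a
  powersOfTwo-isSubsetOfI {m} {zero} 2^m≤0 = ⊥-elim (ℕ.<⇒≱ (ℕ.m^n>0 2 m) 2^m≤0)

  sublistSums : List ℤ → List ℤ
  sublistSums [] = 0ℤ ∷ []
  sublistSums (g ∷ G) = map (_+_ g) (sublistSums G) ++ sublistSums G

  length-sublistSums : ∀ G → length (sublistSums G) ≡ 2 ^ length G
  length-sublistSums [] = refl
  length-sublistSums (g ∷ G) = begin
    length (map (_+_ g) Σs ++ Σs)         ≡⟨ length-++ (map (_+_ g) Σs) ⟩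
    length (map (_+_ g) Σs) ℕ.+ length Σs ≡⟨ cong (ℕ._+ length Σs) (length-map (_+_ g) Σs) ⟩
    length Σs ℕ.+ length Σs              ≡⟨ cong (λ t → t ℕ.+ t) (length-sublistSums G) ⟩
    2 ^ length G ℕ.+ 2 ^ length G        ≡⟨ cong (2 ^ length G ℕ.+_) (sym (ℕ.+-identityʳ _)) ⟩
    2 ^ suc (length G)                   ∎
    where
    open ≡-Reasoning
    Σs = sublistSums G

  sumℤ-∈-sublistSums : ∀ {Z G} → Z ⊆ G → sumℤ Z ∈ sublistSums G
  sumℤ-∈-sublistSums [] = here refl
  sumℤ-∈-sublistSums (g ∷ʳ Z⊆G) = ∈-++⁺ʳ (map (_+_ g) _) (sumℤ-∈-sublistSums Z⊆G)
  sumℤ-∈-sublistSums {G = g ∷ _} (refl ∷ Z⊆G) = ∈-++⁺ˡ (∈-map⁺ (_+_ g) (sumℤ-∈-sublistSums Z⊆G))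

  injective-∈⇒≤-length : ∀ {A : Set} {m} {xs : List A} (f : Fin m → A) → Injective _≡_ _≡_ f →
    (∀ i → f i ∈ xs) → m ℕ.≤ length xs
  injective-∈⇒≤-length {xs = xs} f f-injective f∈xs =
    Fin.injective⇒≤ {f = λ i → index (f∈xs i)} λ {i} {j} eq → f-injective (begin
      f i                           ≡⟨ lookup-index (f∈xs i) ⟩
      lookup xs (index (f∈xs i))    ≡⟨ cong (lookup xs) eq ⟩
      lookup xs (index (f∈xs j))    ≡⟨ lookup-index (f∈xs j) ⟨
      f j                           ∎)
    where open ≡-Reasoning

  [m+n]⊖n≡m : ∀ m n → (m ℕ.+ n) ⊖ n ≡ + m
  [m+n]⊖n≡m m n = trans (≤-⊖ (ℕ.m≤n+m n m)) (cong +_ (ℕ.m+n∸n≡m m n))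

  m⊖n+n≡m : ∀ m n → m ⊖ n + + n ≡ + m
  m⊖n+n≡m m n = trans (distribˡ-⊖-+-pos n m n) ([m+n]⊖n≡m m n)

  intervalElement : ∀ a → Fin (suc (a ℕ.+ a)) → ℤ
  intervalElement a i = toℕ i ⊖ a

  intervalElement-injective : ∀ a → Injective _≡_ _≡_ (intervalElement a)
  intervalElement-injective a {i} {j} eq = Fin.toℕ-injective (+-injective (begin
    + toℕ i                ≡⟨ m⊖n+n≡m (toℕ i) a ⟨
    toℕ i ⊖ a + + a        ≡⟨ cong (_+ + a) eq ⟩
    toℕ j ⊖ a + + a        ≡⟨ m⊖n+n≡m (toℕ j) a ⟩
    + toℕ j                ∎))
    where open ≡-Reasoning

  intervalElement-∈I : ∀ a i → InI a (intervalElement a i)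
  intervalElement-∈I a i =
    ≤-trans (≤-reflexive (sym (⊖-≤ z≤n))) (⊖-monoˡ-≤ a z≤n) ,
    ≤-trans (⊖-monoˡ-≤ a (ℕ.s≤s⁻¹ (Fin.toℕ<n i))) (≤-reflexive ([m+n]⊖n≡m a a))

  generating-set-size : ∀ {a G} → Generates a G → suc (a ℕ.+ a) ℕ.≤ 2 ^ length G
  generating-set-size {a} {G} generates = subst (suc (a ℕ.+ a) ℕ.≤_) (length-sublistSums G)
    (injective-∈⇒≤-length (intervalElement a) (intervalElement-injective a) λ i →
      let Z , Z⊆G , ΣZ≡x , _ = generates (intervalElement a i) (intervalElement-∈I a i) in
      subst (_∈ sublistSums G) ΣZ≡x (sumℤ-∈-sublistSums Z⊆G))

  2^m<2^n⇒m<n : ∀ {m n} → 2 ^ m ℕ.< 2 ^ n → m ℕ.< n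
  2^m<2^n⇒m<n lt = ℕ.≰⇒> λ n≤m → ℕ.<⇒≱ lt (ℕ.^-monoʳ-≤ 2 n≤m)

  minGenCard : ∀ {n a} → 1 ℕ.≤ n → 2 ^ (n ℕ.∸ 1) ℕ.≤ a → a ℕ.< 2 ^ n → MinGenCard a (n ℕ.+ 1)
  minGenCard {suc m} {a} _ 2^m≤a a<2^[1+m] =
    (- (+ a) ∷ powersOfTwo (suc m) ,
     powersOfTwo-isSubsetOfI 2^m≤a ,
     powersOfTwo-generates a<2^[1+m] ,
     trans (cong suc (length-applyDownFrom _ (suc m))) (ℕ.+-comm 1 (suc m))) ,
    λ G _ generates → subst (ℕ._≤ length G) (ℕ.+-comm 1 (suc m))
      (2^m<2^n⇒m<n (ℕ.<-≤-trans (s≤s (ℕ.+-mono-≤ 2^m≤a 2^m+0≤a)) (generating-set-size generates)))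
    where
    2^m+0≤a : 2 ^ m ℕ.+ 0 ℕ.≤ a
    2^m+0≤a = ℕ.≤-trans (ℕ.≤-reflexive (ℕ.+-identityʳ (2 ^ m))) 2^m≤a

open import Data.Nat using (ℕ; _≤_; _<_; _^_; _∸_; _+_)
open import Data.Product using (_×_; _,_)
open Splittings using (partI)
open GeneratingSets using (minGenCard)

lemma3p2 : (n a : ℕ) → 1 ≤ n → 2 ^ (n ∸ 1) ≤ a → a < 2 ^ n →
    (4 < n → PartI n a) × MinGenCard a (n + 1)
lemma3p2 n a 1≤n lo hi = (λ 4<n → partI a 4<n lo hi) , minGenCard 1≤n lo hi
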